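{- Each of the following triples $(c,\gamma,\delta)$ is a solution of the left fish equation: (1) $c(i,j)=t_jz_i+z_j$, $\gamma(i,j)=1$, $\delta(i,j)=t_i$; (2) $c(i,j)=t_jz_i+z_j$, $\gamma(i,j)=z_j$, $\delta(i,j)=-z_i$; (3) $c(i,j)=t_iz_j+z_i$, $\gamma(i,j)=-(t_j+1)z_j$, $\delta(i,j)=(t_i+1)z_it_j$; (4) $c(i,j)=t_iz_j+z_i$, $\gamma(i,j)=t_j+1$, $\delta(i,j)=t_i+1$. Moreover, if $(c,\gamma_1,\delta_1)$ and $(c,\gamma_2,\delta_2)$ are solutions with the same $c$, then $(c,\lambda\gamma_1+\mu\gamma_2,\lambda\delta_1+\mu\delta_2)$ is a solution for all constants $\lambda,\mu\in\mathbb{C}$ (independent of $z_i,z_j,t_i,t_j$).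
   Context: Let $\gamma(i,j),\delta(i,j),c(i,j)$ denote expressions in complex variables $z_i,t_i,z_j,t_j$, and let $\gamma(j,i)$ denote the same expression with $(z_i,t_i)$ and $(z_j,t_j)$ interchanged (similarly for $\delta$). The triple $(c,\gamma,\delta)$ is a solution of the left fish equation if, identically in $z_i,z_j,t_i,t_j$, $$\gamma(i,j)\,c(i,j)=\gamma(j,i)\,(t_j+1)z_j+\delta(j,i)\,(z_i-z_j),$$ $$\delta(i,j)\,c(i,j)=\delta(j,i)\,(t_i+1)z_i+\gamma(j,i)\,(t_iz_j-t_jz_i).$$ -}

module Defs where

open import Level using (_⊔_)
open import Data.Product using (_×_)
open import Algebra.Bundles using (CommutativeRing)

-- Everything is stated over an arbitrary commutative ring R (ℂ is not
-- available in agda-stdlib); ℂ is the intended instance.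
module _ {a ℓ} (R : CommutativeRing a ℓ) where
  open CommutativeRing R

  -- An expression in the variables z_i, t_i, z_j, t_j (argument order:
  -- zi ti zj tj).  e(j,i) is obtained as  e zj tj zi ti.
  Expr : Set a
  Expr = Carrier → Carrier → Carrier → Carrier → Carrier

  LeftFish : Expr → Expr → Expr → Set (a ⊔ ℓ)
  LeftFish c γ δ =
    ∀ zi ti zj tj →
      (γ zi ti zj tj * c zi ti zj tj
         ≈ γ zj tj zi ti * ((tj + 1#) * zj) + δ zj tj zi ti * (zi - zj))
    × (δ zi ti zj tj * c zi ti zj tj
         ≈ δ zj tj zi ti * ((ti + 1#) * zi) + γ zj tj zi ti * (ti * zj - tj * zi))

  c₁ : Expr
  c₁ zi ti zj tj = tj * zi + zj

  c₂ : Expr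
  c₂ zi ti zj tj = ti * zj + zi

  γ₁ δ₁ : Expr
  γ₁ zi ti zj tj = 1#
  δ₁ zi ti zj tj = ti

  γ₂ δ₂ : Expr
  γ₂ zi ti zj tj = zj
  δ₂ zi ti zj tj = - zi

  γ₃ δ₃ : Expr
  γ₃ zi ti zj tj = - ((tj + 1#) * zj)
  δ₃ zi ti zj tj = ((ti + 1#) * zi) * tj

  γ₄ δ₄ : Expr
  γ₄ zi ti zj tj = tj + 1#
  δ₄ zi ti zj tj = ti + 1#

  lincomb : Carrier → Expr → Carrier → Expr → Expr
  lincomb l e₁ m e₂ zi ti zj tj = l * e₁ zi ti zj tj + m * e₂ zi ti zj tj

{-# OPTIONS --safe #-}
module Submission where

-- Each claimed solution amounts to two polynomial identities in z_i, t_i, z_j, t_j, which hold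
-- in every commutative ring and are checked by ring normalisation.  The linear-combination
-- statement holds because, for fixed c, both fish equations are linear in the pair (γ, δ).

open import Algebra.Bundles using (CommutativeRing)

-- Integer coefficients, mapped into R by the canonical map ℤ → R, are what lets normalisation
-- cancel terms such as t z - t z; with R's own elements as coefficients it cannot.
module CommutativeRingSolver {a ℓ} (R : CommutativeRing a ℓ) where
  open import Data.Nat.Base as ℕ using (zero; suc; _∸_; _≤_)
  open import Data.Nat.Properties as ℕ using (_≤?_)
  open import Data.Integer.Base as ℤ using (ℤ; +_; -[1+_]; _⊖_; +-*-rawRing)
  import Data.Integer.Properties as ℤ
  open import Data.Maybe.Base using (map)
  open import Relation.Nullary.Decidable using (yes; no)
  open import Relation.Binary.Consequences using (dec⇒weaklyDec)
  import Relation.Binary.PropositionalEquality.Core as ≡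
  open import Algebra.Solver.Ring.AlmostCommutativeRing
    using (_-Raw-AlmostCommutative⟶_; fromCommutativeRing; Induced-equivalence)
  open import Relation.Binary.Definitions using (WeaklyDecidable)

  open CommutativeRing R
  open import Algebra.Properties.Ring ring
  -- With this _×_, fromℤ (+ 1) reduces to 1#, so the solver's goals match 1# in Defs on the nose.
  open import Algebra.Properties.Semiring.Mult.TCOptimised semiring
  open import Relation.Binary.Reasoning.Setoid setoid

  fromℤ : ℤ → Carrier
  fromℤ (+ n)    = n × 1#
  fromℤ -[1+ n ] = - (suc n × 1#)

  fromℤ-neg : ∀ i → fromℤ (ℤ.- i) ≈ - fromℤ i
  fromℤ-neg (+ zero)  = sym -0#≈0#
  fromℤ-neg (+ suc n) = refl
  fromℤ-neg -[1+ n ]  = sym (-‿involutive _)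

  ×1-homo-∸ : ∀ {m n} → n ≤ m → (m ∸ n) × 1# ≈ m × 1# - n × 1#
  ×1-homo-∸ {m} {n} n≤m = x≈z//y _ _ _ (begin
    (m ∸ n) × 1# + n × 1#  ≈⟨ ×-homo-+ 1# (m ∸ n) n ⟨
    (m ∸ n ℕ.+ n) × 1#     ≡⟨ ≡.cong (_× 1#) (ℕ.m∸n+n≡m n≤m) ⟩
    m × 1#                 ∎)

  fromℤ-⊖ : ∀ m n → fromℤ (m ⊖ n) ≈ m × 1# - n × 1#
  fromℤ-⊖ m n with n ≤? m
  ... | yes n≤m = begin
    fromℤ (m ⊖ n)        ≡⟨ ≡.cong fromℤ (ℤ.⊖-≥ n≤m) ⟩
    (m ∸ n) × 1#         ≈⟨ ×1-homo-∸ n≤m ⟩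
    m × 1# - n × 1#      ∎
  ... | no n≰m = begin
    fromℤ (m ⊖ n)            ≡⟨ ≡.cong fromℤ (ℤ.⊖-≰ n≰m) ⟩
    fromℤ (ℤ.- + (n ∸ m))    ≈⟨ fromℤ-neg (+ (n ∸ m)) ⟩
    - ((n ∸ m) × 1#)         ≈⟨ -‿cong (×1-homo-∸ (ℕ.≰⇒≥ n≰m)) ⟩
    - (n × 1# - m × 1#)      ≈⟨ ⁻¹-anti-homo‿- (n × 1#) (m × 1#) ⟩
    m × 1# - n × 1#          ∎

  fromℤ-+ : ∀ i j → fromℤ (i ℤ.+ j) ≈ fromℤ i + fromℤ j
  fromℤ-+ (+ m)    (+ n)    = ×-homo-+ 1# m n
  fromℤ-+ (+ m)    -[1+ n ] = fromℤ-⊖ m (suc n)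
  fromℤ-+ -[1+ m ] (+ n)    = trans (fromℤ-⊖ n (suc m)) (+-comm _ _)
  fromℤ-+ -[1+ m ] -[1+ n ] = begin
    - (suc (suc (m ℕ.+ n)) × 1#)          ≡⟨ ≡.cong (λ k → - (suc k × 1#)) (ℕ.+-suc m n) ⟨
    - ((suc m ℕ.+ suc n) × 1#)            ≈⟨ -‿cong (×-homo-+ 1# (suc m) (suc n)) ⟩
    - (suc m × 1# + suc n × 1#)           ≈⟨ -‿+-comm (suc m × 1#) (suc n × 1#) ⟨
    - (suc m × 1#) + - (suc n × 1#)       ∎

  fromℤ-* : ∀ i j → fromℤ (i ℤ.* j) ≈ fromℤ i * fromℤ j
  fromℤ-* (+ m) (+ n) = begin
    fromℤ (+ m ℤ.* + n)  ≡⟨ ≡.cong fromℤ (ℤ.+◃n≡+n (m ℕ.* n)) ⟩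
    (m ℕ.* n) × 1#       ≈⟨ ×1-homo-* m n ⟩
    m × 1# * n × 1#      ∎
  fromℤ-* (+ m) -[1+ n ] = begin
    fromℤ (+ m ℤ.* -[1+ n ])        ≡⟨ ≡.cong fromℤ (ℤ.-◃n≡-n (m ℕ.* suc n)) ⟩
    fromℤ (ℤ.- + (m ℕ.* suc n))     ≈⟨ fromℤ-neg (+ (m ℕ.* suc n)) ⟩
    - ((m ℕ.* suc n) × 1#)          ≈⟨ -‿cong (×1-homo-* m (suc n)) ⟩
    - (m × 1# * suc n × 1#)         ≈⟨ -‿distribʳ-* (m × 1#) (suc n × 1#) ⟩
    m × 1# * - (suc n × 1#)         ∎
  fromℤ-* -[1+ m ] (+ n) = begin
    fromℤ (-[1+ m ] ℤ.* + n)        ≡⟨ ≡.cong fromℤ (ℤ.-◃n≡-n (suc m ℕ.* n)) ⟩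
    fromℤ (ℤ.- + (suc m ℕ.* n))     ≈⟨ fromℤ-neg (+ (suc m ℕ.* n)) ⟩
    - ((suc m ℕ.* n) × 1#)          ≈⟨ -‿cong (×1-homo-* (suc m) n) ⟩
    - (suc m × 1# * n × 1#)         ≈⟨ -‿distribˡ-* (suc m × 1#) (n × 1#) ⟩
    - (suc m × 1#) * n × 1#         ∎
  fromℤ-* -[1+ m ] -[1+ n ] = begin
    (suc m ℕ.* suc n) × 1#              ≈⟨ ×1-homo-* (suc m) (suc n) ⟩
    suc m × 1# * suc n × 1#             ≈⟨ -‿involutive _ ⟨
    - - (suc m × 1# * suc n × 1#)       ≈⟨ -‿cong (-‿distribˡ-* _ _) ⟩
    - (- (suc m × 1#) * suc n × 1#)     ≈⟨ -‿distribʳ-* _ _ ⟩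
    - (suc m × 1#) * - (suc n × 1#)     ∎

  fromℤ-homomorphism : +-*-rawRing -Raw-AlmostCommutative⟶ fromCommutativeRing R
  fromℤ-homomorphism = record
    { ⟦_⟧    = fromℤ
    ; +-homo = fromℤ-+
    ; *-homo = fromℤ-*
    ; -‿homo = fromℤ-neg
    ; 0-homo = refl
    ; 1-homo = refl
    }

  fromℤ-≟ : WeaklyDecidable (Induced-equivalence fromℤ-homomorphism)
  fromℤ-≟ i j = map (λ { ≡.refl → refl }) (dec⇒weaklyDec ℤ._≟_ i j)

  open import Algebra.Solver.Ring +-*-rawRing (fromCommutativeRing R) fromℤ-homomorphism fromℤ-≟ public

open import Data.Integer.Base using (+_)
open import Data.Product.Base using (_,_; _×_)
open import Defs

module LeftFishSolutions {a ℓ} (R : CommutativeRing a ℓ) where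
  open CommutativeRing R
  open CommutativeRingSolver R using (solve; _:=_; _:+_; _:*_; _:-_; :-_; con; Polynomial)
  open import Relation.Binary.Reasoning.Setoid setoid

  :1 : ∀ {n} → Polynomial n
  :1 = con (+ 1)

  leftFish-c₁-γ₁-δ₁ : LeftFish R (c₁ R) (γ₁ R) (δ₁ R)
  leftFish-c₁-γ₁-δ₁ zi ti zj tj =
      solve 4 (λ zi ti zj tj → :1 :* (tj :* zi :+ zj)
                := :1 :* ((tj :+ :1) :* zj) :+ tj :* (zi :- zj)) refl zi ti zj tj
    , solve 4 (λ zi ti zj tj → ti :* (tj :* zi :+ zj)
                := tj :* ((ti :+ :1) :* zi) :+ :1 :* (ti :* zj :- tj :* zi)) refl zi ti zj tj

  leftFish-c₁-γ₂-δ₂ : LeftFish R (c₁ R) (γ₂ R) (δ₂ R)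
  leftFish-c₁-γ₂-δ₂ zi ti zj tj =
      solve 4 (λ zi ti zj tj → zj :* (tj :* zi :+ zj)
                := zi :* ((tj :+ :1) :* zj) :+ :- zj :* (zi :- zj)) refl zi ti zj tj
    , solve 4 (λ zi ti zj tj → :- zi :* (tj :* zi :+ zj)
                := :- zj :* ((ti :+ :1) :* zi) :+ zi :* (ti :* zj :- tj :* zi)) refl zi ti zj tj

  leftFish-c₂-γ₃-δ₃ : LeftFish R (c₂ R) (γ₃ R) (δ₃ R)
  leftFish-c₂-γ₃-δ₃ zi ti zj tj =
      solve 4 (λ zi ti zj tj → :- ((tj :+ :1) :* zj) :* (ti :* zj :+ zi)
                := :- ((ti :+ :1) :* zi) :* ((tj :+ :1) :* zj)
                   :+ (tj :+ :1) :* zj :* ti :* (zi :- zj)) refl zi ti zj tj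
    , solve 4 (λ zi ti zj tj → (ti :+ :1) :* zi :* tj :* (ti :* zj :+ zi)
                := (tj :+ :1) :* zj :* ti :* ((ti :+ :1) :* zi)
                   :+ :- ((ti :+ :1) :* zi) :* (ti :* zj :- tj :* zi)) refl zi ti zj tj

  leftFish-c₂-γ₄-δ₄ : LeftFish R (c₂ R) (γ₄ R) (δ₄ R)
  leftFish-c₂-γ₄-δ₄ zi ti zj tj =
      solve 4 (λ zi ti zj tj → (tj :+ :1) :* (ti :* zj :+ zi)
                := (ti :+ :1) :* ((tj :+ :1) :* zj) :+ (tj :+ :1) :* (zi :- zj)) refl zi ti zj tj
    , solve 4 (λ zi ti zj tj → (ti :+ :1) :* (ti :* zj :+ zi)
                := (tj :+ :1) :* ((ti :+ :1) :* zi) :+ (ti :+ :1) :* (ti :* zj :- tj :* zi)) refl zi ti zj tj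

  lincomb-≈-lincomb : ∀ {c g₁ g₂ x a₁ a₂ y b₁ b₂} →
    g₁ * c ≈ a₁ * x + b₁ * y → g₂ * c ≈ a₂ * x + b₂ * y →
    ∀ l m → (l * g₁ + m * g₂) * c ≈ (l * a₁ + m * a₂) * x + (l * b₁ + m * b₂) * y
  lincomb-≈-lincomb {c} {g₁} {g₂} {x} {a₁} {a₂} {y} {b₁} {b₂} eq₁ eq₂ l m = begin
    (l * g₁ + m * g₂) * c                        ≈⟨ distribute l m g₁ g₂ c ⟩
    l * (g₁ * c) + m * (g₂ * c)                  ≈⟨ +-cong (*-congˡ eq₁) (*-congˡ eq₂) ⟩
    l * (a₁ * x + b₁ * y) + m * (a₂ * x + b₂ * y) ≈⟨ collect l m a₁ a₂ b₁ b₂ x y ⟩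
    (l * a₁ + m * a₂) * x + (l * b₁ + m * b₂) * y ∎
    where
    distribute : ∀ l m g₁ g₂ c → (l * g₁ + m * g₂) * c ≈ l * (g₁ * c) + m * (g₂ * c)
    distribute = solve 5 (λ l m g₁ g₂ c → (l :* g₁ :+ m :* g₂) :* c := l :* (g₁ :* c) :+ m :* (g₂ :* c)) refl
    collect : ∀ l m a₁ a₂ b₁ b₂ x y →
      l * (a₁ * x + b₁ * y) + m * (a₂ * x + b₂ * y) ≈ (l * a₁ + m * a₂) * x + (l * b₁ + m * b₂) * y
    collect = solve 8 (λ l m a₁ a₂ b₁ b₂ x y →
      l :* (a₁ :* x :+ b₁ :* y) :+ m :* (a₂ :* x :+ b₂ :* y)
        := (l :* a₁ :+ m :* a₂) :* x :+ (l :* b₁ :+ m :* b₂) :* y) refl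

  leftFish-lincomb : ∀ {c g₁ d₁ g₂ d₂ : Expr R} → LeftFish R c g₁ d₁ → LeftFish R c g₂ d₂ →
    ∀ l m → LeftFish R c (lincomb R l g₁ m g₂) (lincomb R l d₁ m d₂)
  leftFish-lincomb fish₁ fish₂ l m zi ti zj tj
    with (γeq₁ , δeq₁) ← fish₁ zi ti zj tj | (γeq₂ , δeq₂) ← fish₂ zi ti zj tj
    = lincomb-≈-lincomb γeq₁ γeq₂ l m , lincomb-≈-lincomb δeq₁ δeq₂ l m

theorem6p2 : ∀ {a ℓ} (R : CommutativeRing a ℓ) →
      LeftFish R (c₁ R) (γ₁ R) (δ₁ R)
    × LeftFish R (c₁ R) (γ₂ R) (δ₂ R)
    × LeftFish R (c₂ R) (γ₃ R) (δ₃ R)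
    × LeftFish R (c₂ R) (γ₄ R) (δ₄ R)
    × (∀ (c g₁ d₁ g₂ d₂ : Expr R) →
         LeftFish R c g₁ d₁ → LeftFish R c g₂ d₂ →
         ∀ (l m : CommutativeRing.Carrier R) →
           LeftFish R c (lincomb R l g₁ m g₂) (lincomb R l d₁ m d₂))
theorem6p2 R =
    leftFish-c₁-γ₁-δ₁
  , leftFish-c₁-γ₂-δ₂
  , leftFish-c₂-γ₃-δ₃
  , leftFish-c₂-γ₄-δ₄
  , λ _ _ _ _ _ → leftFish-lincomb
  where open LeftFishSolutions R
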